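{- Let $T_1,\dots,T_t$ be $(a,b)$-trees ($b\ge 2a$) such that all elements of $T_i$ are at most all elements of $T_{i+1}$, and suppose each $T_i$ is preprocessed, i.e. no node on its left spine or right spine has degree $b$. Join them sequentially in pairs (first $T_1$ with $T_2$, then the result with $T_3$, and so on) using the standard join of two $(a,b)$-trees, in which the root of the lower tree is attached to (or fused with) the spine node of equal rank of the higher tree and overfull nodes are split upward along the spine. Then over the whole sequence of joins only $O(t)$ node splits of degree-$b$ nodes are performed.
   Context: An $(a,b)$-tree (with $b\ge 2a$) is a search tree in which all leaves have the same depth, every node has degree at most $b$, every non-root node has degree at least $a$, the root has degree at least $\min(2,|T|)$, and elements are stored in the leaves in sorted order. The rank of a node is the number of nodes on a path from it down to a leaf (including itself); the rank of a tree is the rank of its root. The left (right) spine is the path from the root to the leftmost (rightmost) leaf. Standard join of $U$ and $V$ (all keys of $U$ at most all keys of $V$) with $r(U)\ge r(V)$: descend the right spine of $U$ to the node $n$ with rank $r(V)$; if $n$ or the root of $V$ has degree less than $a$ they are fused (using the largest key of $U$ as splitter), and an overfull fused node is split back into two; otherwise the root of $V$ is inserted as a new rightmost child of the parent of $n$; splits of nodes whose degree exceeds $b$ then propagate up the spine as in insertion (the case $r(U)<r(V)$ is symmetric using the left spine of $V$). -}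

module Defs where

open import Level using (0ℓ)
open import Data.Nat using (ℕ; zero; suc; _+_; _*_; _∸_; _≤_; _≤ᵇ_; _/_; _<ᵇ_)
open import Data.Nat.Base using (_⊔_; _⊓_)
open import Data.Bool using (Bool; true; false; if_then_else_; _∨_)
open import Data.List using (List; []; _∷_; _++_; length; take; drop)
open import Data.List.Relation.Unary.All using (All)
open import Data.List.Relation.Unary.Linked using (Linked)
open import Data.List.Membership.Propositional using (_∈_)
open import Data.List.Relation.Unary.Sorted.TotalOrder using (Sorted)
open import Data.Maybe using (Maybe; just; nothing)
open import Data.Product using (_×_; _,_; Σ; ∃)
open import Relation.Binary.Bundles using (TotalOrder)
open import Relation.Binary.PropositionalEquality using (_≢_)
open import Data.Empty using (⊥)

data Tree (A : Set) : Set where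
  leaf : A → Tree A
  node : List (Tree A) → Tree A

module _ {A : Set} where

  degree : Tree A → ℕ
  degree (leaf _)  = 0
  degree (node cs) = length cs

  leaves    : Tree A → List A
  leavesAll : List (Tree A) → List A
  leaves (leaf x)  = x ∷ []
  leaves (node cs) = leavesAll cs
  leavesAll []       = []
  leavesAll (c ∷ cs) = leaves c ++ leavesAll cs

  size : Tree A → ℕ
  size t = length (leaves t)

  -- rank: number of nodes on a path from the node down to a leaf
  -- (measured along the leftmost path; all such paths have the same
  -- length in a valid tree, see `Uniform`)
  rank : Tree A → ℕ
  rank (leaf _)       = 1
  rank (node [])      = 1
  rank (node (c ∷ _)) = suc (rank c)

  data Uniform : ℕ → Tree A → Set where
    uleaf : ∀ x → Uniform 1 (leaf x)
    unode : ∀ {r cs} → All (Uniform r) cs → Uniform (suc r) (node cs)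

  data InnerOK (a b : ℕ) : Tree A → Set where
    okleaf : ∀ x → InnerOK a b (leaf x)
    oknode : ∀ {cs} → a ≤ length cs → length cs ≤ b →
             All (InnerOK a b) cs → InnerOK a b (node cs)

  leftSpine : Tree A → List ℕ
  leftSpine (leaf _)         = 0 ∷ []
  leftSpine (node [])        = 0 ∷ []
  leftSpine (node (c ∷ cs))  = suc (length cs) ∷ leftSpine c

  rightSpine     : Tree A → List ℕ
  rightSpineLast : List (Tree A) → List ℕ
  rightSpine (leaf _)  = 0 ∷ []
  rightSpine (node cs) = length cs ∷ rightSpineLast cs
  rightSpineLast []           = []
  rightSpineLast (c ∷ [])     = rightSpine c
  rightSpineLast (c ∷ d ∷ cs) = rightSpineLast (d ∷ cs)

  Preprocessed : ℕ → Tree A → Set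
  Preprocessed b t = All (_≢ b) (leftSpine t) × All (_≢ b) (rightSpine t)

module _ (O : TotalOrder 0ℓ 0ℓ 0ℓ) where
  open TotalOrder O using () renaming (Carrier to K; _≤_ to _≼_)

  IsABTree : (a b : ℕ) → Tree K → Set
  IsABTree a b (leaf _)  = ⊥   -- root degree 0 < min(2,|T|) = 1: not an (a,b)-tree
  IsABTree a b (node cs) =
    (∃ λ r → Uniform r (node cs)) ×
    (2 ⊓ size (node cs)) ≤ length cs × length cs ≤ b ×
    All (InnerOK a b) cs ×
    Sorted O (leaves (node cs))

  AllBelow : Tree K → Tree K → Set
  AllBelow U V = ∀ {x y} → x ∈ leaves U → y ∈ leaves V → x ≼ y

-- result of joining at some level: one node, or two nodes (the parent
-- must receive an extra child)
data Res (A : Set) : Set where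
  one : Tree A → Res A
  two : Tree A → Tree A → Res A

module Join {A : Set} (a b : ℕ) where

  unsnoc : List (Tree A) → Maybe (List (Tree A) × Tree A)
  unsnoc []       = nothing
  unsnoc (x ∷ xs) with unsnoc xs
  ... | nothing        = just ([] , x)
  ... | just (ys , y)  = just (x ∷ ys , y)

  mkNode : List (Tree A) → Res A × Bool
  mkNode cs with b <ᵇ length cs
  ... | true  = two (node (take (length cs / 2) cs)) (node (drop (length cs / 2) cs)) , true
  ... | false = one (node cs) , false

  fused? : List (Tree A) → List (Tree A) → Bool
  fused? cs ds = (length cs <ᵇ a) ∨ (length ds <ᵇ a)

  -- n and V have equal rank (n is the spine node of the higher tree)
  -- fuse if one of them has degree < a (an overfull fused node is split
  -- back into two; this is not a split of a degree-b node, so it is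
  -- not counted); otherwise the parent of n gets V's root as an extra
  -- child.
  base : Tree A → Tree A → Res A
  base (node cs) (node ds) with fused? cs ds
  ... | true  = Data.Product.proj₁ (mkNode (cs ++ ds))
    where import Data.Product
  ... | false = two (node cs) (node ds)
  base n v = two n v

  count : Bool → ℕ → ℕ
  count true  s = suc s
  count false s = s

  -- r(U) ≥ r(V); descend d = r(U) - r(V) levels along the right spine of U
  joinR : ℕ → Tree A → Tree A → Res A × ℕ
  joinR zero    U V = base U V , 0
  joinR (suc d) (node cs) V with unsnoc cs
  ... | nothing = one (node cs) , 0
  ... | just (init , l) with joinR d l V
  ...   | one t     , s = one (node (init ++ t ∷ [])) , s
  ...   | two t₁ t₂ , s with mkNode (init ++ t₁ ∷ t₂ ∷ [])
  ...     | r , split = r , count split s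
  joinR (suc d) (leaf x) V = one (leaf x) , 0

  -- r(U) < r(V); descend d = r(V) - r(U) levels along the left spine of V
  joinL : ℕ → Tree A → Tree A → Res A × ℕ
  joinL zero    U V = base U V , 0
  joinL (suc d) U (node []) = one (node []) , 0
  joinL (suc d) U (node (f ∷ rest)) with joinL d U f
  ... | one t     , s = one (node (t ∷ rest)) , s
  ... | two t₁ t₂ , s with mkNode (t₁ ∷ t₂ ∷ rest)
  ...   | r , split = r , count split s
  joinL (suc d) U (leaf x) = one (leaf x) , 0

  finish : Res A → Tree A
  finish (one t)     = t
  finish (two t₁ t₂) = node (t₁ ∷ t₂ ∷ [])

  join : Tree A → Tree A → Tree A × ℕ
  join U V with rank V ≤ᵇ rank U
  ... | true  with joinR (rank U ∸ rank V) U V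
  ...   | r , s = finish r , s
  join U V | false with joinL (rank V ∸ rank U) U V
  ...   | r , s = finish r , s

  joinFrom : Tree A → List (Tree A) → Tree A × ℕ
  joinFrom acc []       = acc , 0
  joinFrom acc (T ∷ Ts) with join acc T
  ... | acc' , s with joinFrom acc' Ts
  ...   | res , s' = res , s + s'

  joinAll : List (Tree A) → Maybe (Tree A)
  joinAll [] = nothing
  joinAll (T ∷ Ts) = just (Data.Product.proj₁ (joinFrom T Ts))
    where import Data.Product

  splitsAll : List (Tree A) → ℕ
  splitsAll []       = 0
  splitsAll (T ∷ Ts) = Data.Product.proj₂ (joinFrom T Ts)
    where import Data.Product

module Submission where

-- Potential: Φ t is the number of full nodes (degree exactly b) on the right
-- spine of t.  The accumulated tree U is always the left operand of a join.
-- If U is the higher tree (joinR), the split propagation climbs U's right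
-- spine, and a node is split only if it was full before receiving its extra
-- child; both halves of a node of degree b + 1 are non-full (for b ≥ 3), so
-- each split is paid for by a unit of Φ.  If V is the higher tree (joinL),
-- the propagation climbs V's left spine, where preprocessing forbids full
-- nodes, so no split happens at all.  In either case
--   splits + Φ (U ⋈ V) ≤ Φ U + 2,
-- because only the bottom step (fusion) and the root where propagation stops
-- can create new full nodes, and V's right spine carries no potential.
-- Telescoping over the sequence, starting from Φ T₁ = 0, gives at most 2t
-- splits for t trees.

open import Defs
open import Level using (0ℓ)
open import Data.Nat using (ℕ; zero; suc; _+_; _*_; _∸_; _/_; _≤_; _<_; _<ᵇ_; _≤ᵇ_; z≤n; s≤s; _≟_)
open import Data.Nat.Properties
open import Data.Nat.DivMod using (m*n/n≡m; /-monoˡ-≤)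
open import Data.Nat.Tactic.RingSolver using (solve-∀)
open import Data.Bool using (Bool; true; false)
open import Data.List using (List; []; _∷_; _++_; length; take; drop)
open import Data.List.Properties using (length-++; ++-identityʳ; length-drop; drop-[])
open import Data.List.Relation.Unary.All as All using (All; []; _∷_)
open import Data.List.Relation.Unary.Linked using (Linked)
open import Data.Maybe using (just; nothing)
open import Data.Product using (∃; _×_; _,_; proj₁; proj₂)
open import Data.Sum using (_⊎_; inj₁; inj₂)
open import Relation.Nullary using (yes; no; contradiction)
open import Relation.Nullary.Reflects using (ofʸ; ofⁿ)
open import Relation.Binary.Bundles using (TotalOrder)
open import Relation.Binary.PropositionalEquality

upperHalf≤ : ∀ m n → n ≤ m + m → n ∸ n / 2 ≤ m
upperHalf≤ m n n≤2m with ≤-total n m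
... | inj₁ n≤m = ≤-trans (m∸n≤m n (n / 2)) n≤m
... | inj₂ m≤n = m≤n+o⇒m∸n≤o n (n / 2) n≤half+m
  where
  open ≤-Reasoning
  d = n ∸ m
  d+m≡n : d + m ≡ n
  d+m≡n = m∸n+n≡m m≤n
  twice-d≤n : d * 2 ≤ n
  twice-d≤n = begin
    d * 2        ≡⟨ *-comm d 2 ⟩
    d + (d + 0)  ≡⟨ cong (d +_) (+-identityʳ d) ⟩
    d + d        ≤⟨ +-monoʳ-≤ d (m≤n+o⇒m∸n≤o n m n≤2m) ⟩
    d + m        ≡⟨ d+m≡n ⟩
    n            ∎
  n≤half+m : n ≤ n / 2 + m
  n≤half+m = subst (_≤ n / 2 + m) d+m≡n
    (+-monoˡ-≤ m (subst (_≤ n / 2) (m*n/n≡m d 2) (/-monoˡ-≤ 2 twice-d≤n)))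

upperHalf< : ∀ b → 3 ≤ b → suc b ∸ suc b / 2 < b
upperHalf< _ (s≤s (s≤s (s≤s {n = k} _))) =
  s≤s (upperHalf≤ (2 + k) (4 + k) (s≤s (s≤s (m≤n+m (2 + k) k))))

2+-inside : ∀ x y → 2 + (x + y) ≡ x + (2 + y)
2+-inside = solve-∀

budget-swap : ∀ x y → x + (2 + y) ≡ y + (x + 2)
budget-swap = solve-∀

module _ {A : Set} where

  rightSpineLast-++ : ∀ (xs : List (Tree A)) y ys →
                      rightSpineLast (xs ++ y ∷ ys) ≡ rightSpineLast (y ∷ ys)
  rightSpineLast-++ []            y ys = refl
  rightSpineLast-++ (x ∷ [])      y ys = refl
  rightSpineLast-++ (x ∷ x′ ∷ xs) y ys = rightSpineLast-++ (x′ ∷ xs) y ys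

  rightSpine-snoc : ∀ (xs : List (Tree A)) t →
                    rightSpine (node (xs ++ t ∷ [])) ≡ length xs + 1 ∷ rightSpine t
  rightSpine-snoc xs t = cong₂ _∷_ (length-++ xs) (rightSpineLast-++ xs t [])

  rightSpineLast-append : ∀ (cs ds : List (Tree A)) →
    rightSpineLast (cs ++ ds) ≡ rightSpineLast cs ⊎ rightSpineLast (cs ++ ds) ≡ rightSpineLast ds
  rightSpineLast-append cs []       = inj₁ (cong rightSpineLast (++-identityʳ cs))
  rightSpineLast-append cs (d ∷ ds) = inj₂ (rightSpineLast-++ cs d ds)

  rightSpineLast-drop : ∀ k (xs : List (Tree A)) →
    rightSpineLast (drop k xs) ≡ rightSpineLast xs ⊎ rightSpineLast (drop k xs) ≡ []
  rightSpineLast-drop zero    xs           = inj₁ refl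
  rightSpineLast-drop (suc k) []           = inj₂ refl
  rightSpineLast-drop (suc k) (x ∷ [])     rewrite drop-[] {A = Tree A} k = inj₂ refl
  rightSpineLast-drop (suc k) (x ∷ y ∷ ys) = rightSpineLast-drop k (y ∷ ys)

-- Analysis of the instrumented join with fusion threshold a and maximal
-- degree b; the value of a plays no role in the counting.
module JoinAnalysis {A : Set} (a b : ℕ) where
  open Join {A} a b

  unsnoc≡nothing⇒[] : ∀ xs → unsnoc xs ≡ nothing → xs ≡ []
  unsnoc≡nothing⇒[] []       _ = refl
  unsnoc≡nothing⇒[] (x ∷ xs) e with unsnoc xs
  unsnoc≡nothing⇒[] (x ∷ xs) () | nothing
  unsnoc≡nothing⇒[] (x ∷ xs) () | just _

  unsnoc≡just : ∀ xs {i l} → unsnoc xs ≡ just (i , l) → xs ≡ i ++ l ∷ []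
  unsnoc≡just (x ∷ xs) eq with unsnoc xs in e
  unsnoc≡just (x ∷ xs) refl | nothing       = cong (x ∷_) (unsnoc≡nothing⇒[] xs e)
  unsnoc≡just (x ∷ xs) refl | just (ys , y) = cong (x ∷_) (unsnoc≡just xs e)

  data MkNodeView (xs : List (Tree A)) : Res A × Bool → Set where
    splits : b < length xs →
             MkNodeView xs (two (node (take (length xs / 2) xs)) (node (drop (length xs / 2) xs)) , true)
    fits   : length xs ≤ b → MkNodeView xs (one (node xs) , false)

  mkNode-view : ∀ xs → MkNodeView xs (mkNode xs)
  mkNode-view xs with b <ᵇ length xs | <ᵇ-reflects-< b (length xs)
  ... | true  | ofʸ b<n = splits b<n
  ... | false | ofⁿ b≮n = fits (≮⇒≥ b≮n)

  count-+ : ∀ split s → count split s ≡ count split 0 + s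
  count-+ true  s = refl
  count-+ false s = refl

  fullBit : ℕ → ℕ
  fullBit x with x ≟ b
  ... | yes _ = 1
  ... | no  _ = 0

  fullBit≤1 : ∀ x → fullBit x ≤ 1
  fullBit≤1 x with x ≟ b
  ... | yes _ = ≤-refl
  ... | no  _ = z≤n

  fullBit-full : fullBit b ≡ 1
  fullBit-full with b ≟ b
  ... | yes _  = refl
  ... | no b≢b = contradiction refl b≢b

  fullBit-notFull : ∀ {x} → x ≢ b → fullBit x ≡ 0
  fullBit-notFull {x} x≢b with x ≟ b
  ... | yes x≡b = contradiction x≡b x≢b
  ... | no  _   = refl

  #full : List ℕ → ℕ
  #full []       = 0
  #full (x ∷ xs) = fullBit x + #full xs

  #full-none : ∀ {xs} → All (_≢ b) xs → #full xs ≡ 0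
  #full-none []               = refl
  #full-none (x≢b ∷ xs≢b) = cong₂ _+_ (fullBit-notFull x≢b) (#full-none xs≢b)

  #full-either : ∀ {L L₁ L₂} → L ≡ L₁ ⊎ L ≡ L₂ → #full L ≤ #full L₁ + #full L₂
  #full-either {L₁ = L₁} (inj₁ refl) = m≤m+n (#full L₁) _
  #full-either {L₁ = L₁} (inj₂ refl) = m≤n+m _ (#full L₁)

  all-either : ∀ {P : ℕ → Set} {L L₁ L₂} → L ≡ L₁ ⊎ L ≡ L₂ → All P L₁ → All P L₂ → All P L
  all-either (inj₁ refl) p₁ _  = p₁
  all-either (inj₂ refl) _  p₂ = p₂

  Φ : Tree A → ℕ
  Φ t = #full (rightSpine t)

  SpineBounded : Tree A → Set
  SpineBounded t = All (_≤ b) (rightSpine t)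

  -- A result of the join at some level; a second node is a pending extra
  -- child for the parent and costs one unit of potential.
  ΦR : Res A → ℕ
  ΦR (one t)   = Φ t
  ΦR (two _ t) = suc (Φ t)

  -- The spine that continues upward is the one of the right node.
  BoundedR : Res A → Set
  BoundedR (one t)   = SpineBounded t
  BoundedR (two _ t) = SpineBounded t

  data DegreeBounded : Tree A → Set where
    bounded-leaf : ∀ x → DegreeBounded (leaf x)
    bounded-node : ∀ {cs} → length cs ≤ b → All DegreeBounded cs → DegreeBounded (node cs)

  degreeBounded⇒spineBounded     : ∀ {t} → DegreeBounded t → SpineBounded t
  degreeBounded⇒lastSpineBounded : ∀ {cs} → All DegreeBounded cs → All (_≤ b) (rightSpineLast cs)
  degreeBounded⇒spineBounded (bounded-leaf x)     = z≤n ∷ []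
  degreeBounded⇒spineBounded (bounded-node n≤b ds) = n≤b ∷ degreeBounded⇒lastSpineBounded ds
  degreeBounded⇒lastSpineBounded []               = []
  degreeBounded⇒lastSpineBounded (d ∷ [])         = degreeBounded⇒spineBounded d
  degreeBounded⇒lastSpineBounded (_ ∷ d′ ∷ ds)    = degreeBounded⇒lastSpineBounded (d′ ∷ ds)

  innerOK⇒degreeBounded  : ∀ {t} → InnerOK a b t → DegreeBounded t
  innerOKs⇒degreeBounded : ∀ {cs} → All (InnerOK a b) cs → All DegreeBounded cs
  innerOK⇒degreeBounded (okleaf x)         = bounded-leaf x
  innerOK⇒degreeBounded (oknode _ n≤b oks) = bounded-node n≤b (innerOKs⇒degreeBounded oks)
  innerOKs⇒degreeBounded []         = []
  innerOKs⇒degreeBounded (ok ∷ oks) = innerOK⇒degreeBounded ok ∷ innerOKs⇒degreeBounded oks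

  upper : List (Tree A) → Tree A
  upper xs = node (drop (length xs / 2) xs)

  upper-bounded : ∀ xs → length xs ∸ length xs / 2 ≤ b → All (_≤ b) (rightSpineLast xs) →
                  SpineBounded (upper xs)
  upper-bounded xs deg≤b sb =
    subst (_≤ b) (sym (length-drop (length xs / 2) xs)) deg≤b
    ∷ all-either (rightSpineLast-drop (length xs / 2) xs) sb []

  upper-Φ : ∀ xs → Φ (upper xs) ≤ fullBit (length xs ∸ length xs / 2) + #full (rightSpineLast xs)
  upper-Φ xs rewrite length-drop (length xs / 2) xs =
    +-monoʳ-≤ _ (≤-trans (#full-either (rightSpineLast-drop (length xs / 2) xs))
                         (≤-reflexive (+-identityʳ _)))

  mkNode-fused : ∀ xs → length xs ≤ b + b → All (_≤ b) (rightSpineLast xs) →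
    BoundedR (proj₁ (mkNode xs)) × ΦR (proj₁ (mkNode xs)) ≤ 2 + #full (rightSpineLast xs)
  mkNode-fused xs n≤2b sb with mkNode xs | mkNode-view xs
  ... | _ | splits _ =
    upper-bounded xs (upperHalf≤ b _ n≤2b) sb
    , s≤s (≤-trans (upper-Φ xs) (+-monoˡ-≤ _ (fullBit≤1 _)))
  ... | _ | fits n≤b = n≤b ∷ sb , ≤-trans (+-monoˡ-≤ _ (fullBit≤1 _)) (n≤1+n _)

  pair-sound : ∀ U V → SpineBounded V → BoundedR (two U V) × ΦR (two U V) ≤ Φ U + (2 + Φ V)
  pair-sound U V sv = sv , ≤-trans (n≤1+n _) (m≤n+m _ (Φ U))

  base-sound : ∀ U V → SpineBounded U → SpineBounded V →
               BoundedR (base U V) × ΦR (base U V) ≤ Φ U + (2 + Φ V)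
  base-sound (leaf x)  V        _ sv = pair-sound (leaf x) V sv
  base-sound (node cs) (leaf y) _ sv = pair-sound (node cs) (leaf y) sv
  base-sound (node cs) (node ds) (lc ∷ sc) (ld ∷ sd) with fused? cs ds
  ... | false = pair-sound (node cs) (node ds) (ld ∷ sd)
  ... | true  with mkNode-fused (cs ++ ds) n≤2b (all-either (rightSpineLast-append cs ds) sc sd)
    where n≤2b = subst (_≤ b + b) (sym (length-++ cs)) (+-mono-≤ lc ld)
  ...   | bounded , pot = bounded , ≤-trans pot budget
    where
    open ≤-Reasoning
    X = #full (rightSpineLast cs)
    Y = #full (rightSpineLast ds)
    budget : 2 + #full (rightSpineLast (cs ++ ds)) ≤ Φ (node cs) + (2 + Φ (node ds))
    budget = begin
      2 + #full (rightSpineLast (cs ++ ds)) ≤⟨ +-monoʳ-≤ 2 (#full-either (rightSpineLast-append cs ds)) ⟩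
      2 + (X + Y)                          ≡⟨ 2+-inside X Y ⟩
      X + (2 + Y)                          ≤⟨ +-mono-≤ (m≤n+m X _) (+-monoʳ-≤ 2 (m≤n+m Y _)) ⟩
      Φ (node cs) + (2 + Φ (node ds))      ∎

  -- Replacing the first child f of a node by a result with e pending units
  -- and main node t changes the spine below the root only if f was the only
  -- child; otherwise the e units are absorbed by a budget k ≥ e.
  replace-first : ∀ e k t f rest → e ≤ k → SpineBounded t → All DegreeBounded rest →
    e + Φ t ≤ Φ f + k →
    All (_≤ b) (rightSpineLast (t ∷ rest)) ×
    e + #full (rightSpineLast (t ∷ rest)) ≤ #full (rightSpineLast (f ∷ rest)) + k
  replace-first e k t f []       e≤k st _    pot = st , pot
  replace-first e k t f (y ∷ ys) e≤k _  drest _   =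
    degreeBounded⇒lastSpineBounded drest , ≤-trans (+-monoˡ-≤ _ e≤k) (≤-reflexive (+-comm k _))

  lift-first : ∀ k f rest x → x ≤ #full (rightSpineLast (f ∷ rest)) + k →
               fullBit (length (f ∷ rest)) + x ≤ Φ (node (f ∷ rest)) + k
  lift-first k f rest x pot = ≤-trans (+-monoʳ-≤ F pot) (≤-reflexive (sym (+-assoc F _ k)))
    where F = fullBit (length (f ∷ rest))

  LeftDescent : Tree A → Tree A → Res A × ℕ → Set
  LeftDescent U V (r , s) = BoundedR r × ΦR r ≤ Φ V + (Φ U + 2) × s ≡ 0

  -- A node on V's left spine has degree < b, so receiving one extra child
  -- never splits it.
  joinL-sound : ∀ d U V → SpineBounded U → DegreeBounded V → All (_≢ b) (leftSpine V) →
                LeftDescent U V (joinL d U V)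
  joinL-sound zero U V su dv _ with base-sound U V su (degreeBounded⇒spineBounded dv)
  ... | bounded , pot = bounded , ≤-trans pot (≤-reflexive (budget-swap (Φ U) (Φ V))) , refl
  joinL-sound (suc d) U (leaf x)  _ dv _ = degreeBounded⇒spineBounded dv , m≤m+n _ _ , refl
  joinL-sound (suc d) U (node []) _ dv _ = degreeBounded⇒spineBounded dv , m≤m+n _ _ , refl
  joinL-sound (suc d) U (node (f ∷ rest)) su (bounded-node deg≤b (df ∷ drest)) (notFull ∷ lsf)
    with joinL d U f | joinL-sound d U f su df lsf
  ... | one t , s | st , pot , s≡0 with replace-first 0 (Φ U + 2) t f rest z≤n st drest pot
  ...   | sb , pot′ = deg≤b ∷ sb , lift-first (Φ U + 2) f rest _ pot′ , s≡0
  joinL-sound (suc d) U (node (f ∷ rest)) su (bounded-node deg≤b (df ∷ drest)) (notFull ∷ lsf)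
    | two t₁ t₂ , s | st , pot , s≡0 with mkNode (t₁ ∷ t₂ ∷ rest) | mkNode-view (t₁ ∷ t₂ ∷ rest)
  ... | _ | splits b<n = contradiction (≤-antisym deg≤b (≤-pred b<n)) notFull
  ... | _ | fits n≤b with replace-first 1 (Φ U + 2) t₂ f rest 1≤k st drest pot
    where 1≤k = ≤-trans (n≤1+n 1) (m≤n+m 2 (Φ U))
  ...   | sb , pot′ = n≤b ∷ sb ,
    ≤-trans (+-monoˡ-≤ _ (fullBit≤1 _)) (≤-trans (m≤n+m _ _) (lift-first (Φ U + 2) f rest _ pot′)) , s≡0

  bounded-snoc⁻ : ∀ i t → SpineBounded (node (i ++ t ∷ [])) → length i + 1 ≤ b × SpineBounded t
  bounded-snoc⁻ i t sb with subst (All (_≤ b)) (rightSpine-snoc i t) sb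
  ... | deg≤b ∷ st = deg≤b , st

  bounded-snoc : ∀ i t → length i + 1 ≤ b → SpineBounded t → SpineBounded (node (i ++ t ∷ []))
  bounded-snoc i t deg≤b st = subst (All (_≤ b)) (sym (rightSpine-snoc i t)) (deg≤b ∷ st)

  lift-last : ∀ k i l x s → x + s ≤ Φ l + k →
              fullBit (length i + 1) + x + s ≤ Φ (node (i ++ l ∷ [])) + k
  lift-last k i l x s pot = begin
    F + x + s       ≡⟨ +-assoc F x s ⟩
    F + (x + s)     ≤⟨ +-monoʳ-≤ F pot ⟩
    F + (Φ l + k)   ≡⟨ sym (+-assoc F _ k) ⟩
    F + Φ l + k     ≡⟨ cong (λ L → #full L + k) (sym (rightSpine-snoc i l)) ⟩
    Φ (node (i ++ l ∷ [])) + k ∎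
    where
    open ≤-Reasoning
    F = fullBit (length i + 1)

  Input : Tree A → Set
  Input V = DegreeBounded V × Preprocessed b V

  module _ (3≤b : 3 ≤ b) where

    -- A node of degree m ≤ b that received one extra child is split only if
    -- it was full, and then its right half is not full: the split is paid
    -- for by the unit of potential the full node carried.
    mkNode-grown : ∀ {m} xs → length xs ≡ suc m → m ≤ b → All (_≤ b) (rightSpineLast xs) →
      BoundedR (proj₁ (mkNode xs)) ×
      ΦR (proj₁ (mkNode xs)) + count (proj₂ (mkNode xs)) 0 ≤ suc (fullBit m + #full (rightSpineLast xs))
    mkNode-grown {m} xs len≡ m≤b sb with mkNode xs | mkNode-view xs
    ... | _ | splits b<n = upper-bounded xs (<⇒≤ half<b) sb , (begin
      suc (Φ (upper xs)) + 1  ≡⟨ +-comm _ 1 ⟩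
      2 + Φ (upper xs)        ≤⟨ +-monoʳ-≤ 2 (upper-Φ xs) ⟩
      2 + (fullBit h + R)     ≡⟨ cong (λ z → 2 + (z + R)) (fullBit-notFull (<⇒≢ half<b)) ⟩
      2 + R                   ≡⟨ cong (λ z → suc (z + R)) (sym (trans (cong fullBit m≡b) fullBit-full)) ⟩
      suc (fullBit m + R)     ∎)
      where
      open ≤-Reasoning
      R = #full (rightSpineLast xs)
      h = length xs ∸ length xs / 2
      m≡b : m ≡ b
      m≡b = ≤-antisym m≤b (≤-pred (subst (b <_) len≡ b<n))
      half<b : h < b
      half<b = subst (λ n → n ∸ n / 2 < b) (sym (trans len≡ (cong suc m≡b))) (upperHalf< b 3≤b)
    ... | _ | fits n≤b = n≤b ∷ sb ,
      ≤-trans (≤-reflexive (+-identityʳ _))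
              (≤-trans (+-monoˡ-≤ R (fullBit≤1 _)) (s≤s (m≤n+m R _)))
      where R = #full (rightSpineLast xs)

    -- joinR returned two nodes t₁ t₂ for the last child l: the parent gets
    -- them in place of l and is rebuilt, possibly splitting.
    carry-sound : ∀ k i l t₁ t₂ s → SpineBounded (node (i ++ l ∷ [])) → SpineBounded t₂ →
      suc (Φ t₂) + s ≤ Φ l + k →
      BoundedR (proj₁ (mkNode (i ++ t₁ ∷ t₂ ∷ []))) ×
      ΦR (proj₁ (mkNode (i ++ t₁ ∷ t₂ ∷ []))) + count (proj₂ (mkNode (i ++ t₁ ∷ t₂ ∷ []))) s
        ≤ Φ (node (i ++ l ∷ [])) + k
    carry-sound k i l t₁ t₂ s sp st pot = proj₁ grown , (begin
      P + count split s         ≡⟨ cong (P +_) (count-+ split s) ⟩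
      P + (count split 0 + s)   ≡⟨ sym (+-assoc P _ s) ⟩
      P + count split 0 + s     ≤⟨ +-monoˡ-≤ s (subst (λ L → P + count split 0 ≤ suc (F + #full L)) last≡ (proj₂ grown)) ⟩
      suc (F + Φ t₂) + s        ≡⟨ cong (_+ s) (sym (+-suc F (Φ t₂))) ⟩
      F + suc (Φ t₂) + s        ≤⟨ lift-last k i l (suc (Φ t₂)) s pot ⟩
      Φ (node (i ++ l ∷ [])) + k ∎)
      where
      open ≤-Reasoning
      xs = i ++ t₁ ∷ t₂ ∷ []
      P = ΦR (proj₁ (mkNode xs))
      split = proj₂ (mkNode xs)
      F = fullBit (length i + 1)
      last≡ : rightSpineLast xs ≡ rightSpine t₂
      last≡ = rightSpineLast-++ i t₁ (t₂ ∷ [])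
      grown = mkNode-grown xs (trans (length-++ i) (+-suc (length i) 1)) (proj₁ (bounded-snoc⁻ i l sp))
                (subst (All (_≤ b)) (sym last≡) st)

    RightDescent : Tree A → Tree A → Res A × ℕ → Set
    RightDescent U V (r , s) = BoundedR r × ΦR r + s ≤ Φ U + (2 + Φ V)

    joinR-sound : ∀ d U V → SpineBounded U → SpineBounded V → RightDescent U V (joinR d U V)
    joinR-sound zero U V su sv with base-sound U V su sv
    ... | bounded , pot = bounded , ≤-trans (≤-reflexive (+-identityʳ _)) pot
    joinR-sound (suc d) (leaf x) V su _ = su , +-monoʳ-≤ _ z≤n
    joinR-sound (suc d) (node cs) V su sv with unsnoc cs in eq
    ... | nothing = su , +-monoʳ-≤ _ z≤n
    ... | just (i , l) with unsnoc≡just cs eq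
    ... | refl with joinR d l V | joinR-sound d l V (proj₂ (bounded-snoc⁻ i l su)) sv
    ... | one t , s | st , pot =
      bounded-snoc i t (proj₁ (bounded-snoc⁻ i l su)) st ,
      subst (λ L → #full L + s ≤ Φ (node (i ++ l ∷ [])) + (2 + Φ V)) (sym (rightSpine-snoc i t)) (lift-last (2 + Φ V) i l (Φ t) s pot)
    ... | two t₁ t₂ , s | st , pot = carry-sound (2 + Φ V) i l t₁ t₂ s su st pot

    -- A new root has degree 2 < b and adds no full node.
    finish-sound : ∀ r → BoundedR r → SpineBounded (finish r) × Φ (finish r) ≤ ΦR r
    finish-sound (one t)     st = st , ≤-refl
    finish-sound (two t₁ t₂) st = ≤-trans (n≤1+n 2) 3≤b ∷ st , +-monoˡ-≤ (Φ t₂) (fullBit≤1 2)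

    -- One join: the splits plus the new potential stay within Φ U + 2, since
    -- the right spine of a preprocessed V carries no potential.
    join-sound : ∀ U V → SpineBounded U → Input V →
      SpineBounded (proj₁ (join U V)) × Φ (proj₁ (join U V)) + proj₂ (join U V) ≤ Φ U + 2
    join-sound U V su (dv , leftOK , rightOK) with rank V ≤ᵇ rank U
    ... | true with joinR (rank U ∸ rank V) U V | joinR-sound (rank U ∸ rank V) U V su (degreeBounded⇒spineBounded dv)
    ...   | r , s | br , pot = proj₁ (finish-sound r br) , (begin
      Φ (finish r) + s   ≤⟨ +-monoˡ-≤ s (proj₂ (finish-sound r br)) ⟩
      ΦR r + s           ≤⟨ pot ⟩
      Φ U + (2 + Φ V)    ≡⟨ cong (λ z → Φ U + (2 + z)) (#full-none rightOK) ⟩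
      Φ U + 2            ∎)
      where open ≤-Reasoning
    join-sound U V su (dv , leftOK , rightOK) | false
      with joinL (rank V ∸ rank U) U V | joinL-sound (rank V ∸ rank U) U V su dv leftOK
    ...   | r , s | br , pot , refl = proj₁ (finish-sound r br) , (begin
      Φ (finish r) + 0   ≡⟨ +-identityʳ _ ⟩
      Φ (finish r)       ≤⟨ proj₂ (finish-sound r br) ⟩
      ΦR r               ≤⟨ pot ⟩
      Φ V + (Φ U + 2)    ≡⟨ cong (_+ (Φ U + 2)) (#full-none rightOK) ⟩
      Φ U + 2            ∎)
      where open ≤-Reasoning

    joinFrom-splits : ∀ acc Ts → SpineBounded acc → All Input Ts →
                      proj₂ (joinFrom acc Ts) ≤ Φ acc + 2 * length Ts
    joinFrom-splits acc []       _  []          = z≤n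
    joinFrom-splits acc (T ∷ Ts) sa (inT ∷ ins) with join acc T | join-sound acc T sa inT
    ... | acc′ , s | sa′ , pot with joinFrom acc′ Ts | joinFrom-splits acc′ Ts sa′ ins
    ...   | _ , s′ | later = begin
      s + s′                  ≤⟨ +-monoʳ-≤ s later ⟩
      s + (Φ acc′ + 2 * n)    ≡⟨ sym (+-assoc s _ _) ⟩
      s + Φ acc′ + 2 * n      ≡⟨ cong (_+ 2 * n) (+-comm s _) ⟩
      Φ acc′ + s + 2 * n      ≤⟨ +-monoˡ-≤ (2 * n) pot ⟩
      Φ acc + 2 + 2 * n       ≡⟨ +-assoc (Φ acc) 2 (2 * n) ⟩
      Φ acc + (2 + 2 * n)     ≡⟨ cong (Φ acc +_) (sym (*-suc 2 n)) ⟩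
      Φ acc + 2 * suc n       ∎
      where
      open ≤-Reasoning
      n = length Ts

    -- The first tree is preprocessed, so it starts with potential 0.
    splitsAll-bound : ∀ Ts → All Input Ts → splitsAll Ts ≤ 2 * length Ts
    splitsAll-bound []       []                         = z≤n
    splitsAll-bound (T ∷ Ts) ((dT , _ , rightOK) ∷ ins) =
      ≤-trans (joinFrom-splits T Ts (degreeBounded⇒spineBounded dT) ins)
              (≤-trans (≤-reflexive (cong (_+ 2 * length Ts) (#full-none rightOK)))
                       (*-monoʳ-≤ 2 (n≤1+n _)))

lemma5 : (O : TotalOrder 0ℓ 0ℓ 0ℓ) → (a b : ℕ) → 2 ≤ a → 2 * a ≤ b →
         ∃ λ c → (Ts : List (Tree (TotalOrder.Carrier O))) →
           All (IsABTree O a b) Ts →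
           All (Preprocessed b) Ts →
           Linked (AllBelow O) Ts →
           Join.splitsAll a b Ts ≤ c * length Ts
-- The theorem, with c = 2.
lemma5 O a b 2≤a 2a≤b =
  2 , λ Ts abTrees preprocessed _ →
    splitsAll-bound 3≤b Ts (All.zipWith (λ (ab , pp) → abTree⇒degreeBounded ab , pp) (abTrees , preprocessed))
  where
  open JoinAnalysis {TotalOrder.Carrier O} a b

  -- 3 ≤ 4 ≤ 2a ≤ b
  3≤b : 3 ≤ b
  3≤b = ≤-trans (n≤1+n 3) (≤-trans (*-monoʳ-≤ 2 2≤a) 2a≤b)

  abTree⇒degreeBounded : ∀ {T} → IsABTree O a b T → DegreeBounded T
  abTree⇒degreeBounded {leaf _} ()
  abTree⇒degreeBounded {node cs} (_ , _ , deg≤b , inner , _) =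
    bounded-node deg≤b (innerOKs⇒degreeBounded inner)
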